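{- Let $(V,\in)$ be an $\in$-structure and $\varphi:V\to\mathsf{Type}$ a type family. Then the type $\sum_{x:V}\prod_{z:V}(z\in x\simeq\varphi\,z)$ is a proposition.
   Context: Homotopy type theory with univalent universes and function extensionality. An $\in$-structure is a type $V:\mathsf{Type}$ with $\in:V\to V\to\mathsf{Type}$ such that for all $x,y:V$ the canonical map $(x=y)\to\prod_{z:V}(z\in x\simeq z\in y)$ (sending $\mathrm{refl}$ to the family of identity equivalences) is an equivalence. -}

{-# OPTIONS --without-K #-}
module Defs where

open import Level using (Level; _⊔_; suc)
open import Data.Product using (Σ; _,_; proj₁; proj₂)
open import Relation.Binary.PropositionalEquality using (_≡_; refl)

private
  variable
    a b : Level

isContr : Set a → Set a
isContr A = Σ A λ c → (x : A) → c ≡ x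

isProp : Set a → Set a
isProp A = (x y : A) → x ≡ y

fiber : {A : Set a} {B : Set b} → (A → B) → B → Set (a ⊔ b)
fiber {A = A} f y = Σ A λ x → f x ≡ y

isEquiv : {A : Set a} {B : Set b} → (A → B) → Set (a ⊔ b)
isEquiv {B = B} f = (y : B) → isContr (fiber f y)

_≃_ : Set a → Set b → Set (a ⊔ b)
A ≃ B = Σ (A → B) isEquiv

infix 4 _≃_

id-isEquiv : {A : Set a} → isEquiv (λ (x : A) → x)
id-isEquiv y = (y , refl) , λ { (x , refl) → refl }

idEquiv : (A : Set a) → A ≃ A
idEquiv A = (λ x → x) , id-isEquiv

FunExt : (ℓ : Level) → Set (suc ℓ)
FunExt ℓ = {A : Set ℓ} {B : A → Set ℓ} {f g : (x : A) → B x}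
         → ((x : A) → f x ≡ g x) → f ≡ g

idToEquiv : {ℓ : Level} (A B : Set ℓ) → A ≡ B → A ≃ B
idToEquiv A .A refl = idEquiv A

Univalence : (ℓ : Level) → Set (suc ℓ)
Univalence ℓ = (A B : Set ℓ) → isEquiv (idToEquiv A B)

module _ {ℓ : Level} {V : Set ℓ} (_∈_ : V → V → Set ℓ) where

  idToElemEquiv : (x y : V) → x ≡ y → (z : V) → (z ∈ x) ≃ (z ∈ y)
  idToElemEquiv x .x refl z = idEquiv (z ∈ x)

  isExtensional : Set ℓ
  isExtensional = (x y : V) → isEquiv (idToElemEquiv x y)

record ∈-Structure (ℓ : Level) : Set (suc ℓ) where
  field
    V         : Set ℓ
    _∈_       : V → V → Set ℓ
    extensional : isExtensional _∈_

{-# OPTIONS --without-K #-}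
-- Given two points (x , e) and (y , f), transport e and f into paths by univalence and
-- glue them through φ z into a family of equivalences z ∈ x ≃ z ∈ y. Extensionality turns
-- this family into a path p : x ≡ y whose induced family is the glued one; after path
-- induction on p the glued family is the identity, which by injectivity of idToEquiv
-- forces ua (e z) ≡ ua (f z), hence e ≡ f by function extensionality.
module Submission where

open import Defs
open import Level using (Level)
open import Data.Product using (Σ; _,_; proj₁; proj₂)
open import Relation.Binary.PropositionalEquality
  using (_≡_; refl; sym; trans; cong; cong-app; module ≡-Reasoning)
open import Relation.Binary.PropositionalEquality.Properties
  using (trans-symʳ; trans-injectiveˡ)

private
  variable
    ℓ : Level

≡-from-trans-sym : {A : Set ℓ} {a b : A} (p q : a ≡ b) → refl ≡ trans p (sym q) → p ≡ q
≡-from-trans-sym p q h = trans-injectiveˡ (sym q) (trans (sym h) (sym (trans-symʳ q)))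

module _ (U : Univalence ℓ) {A B : Set ℓ} where

  ua : A ≃ B → A ≡ B
  ua e = proj₁ (proj₁ (U A B e))

  idToEquiv-ua : (e : A ≃ B) → idToEquiv A B (ua e) ≡ e
  idToEquiv-ua e = proj₂ (proj₁ (U A B e))

  idToEquiv-injective : (p q : A ≡ B) → idToEquiv A B p ≡ idToEquiv A B q → p ≡ q
  idToEquiv-injective p q h =
    trans (sym (cong proj₁ (centre-unique (p , h))))
          (cong proj₁ (centre-unique (q , refl)))
    where
    centre-unique : (w : fiber (idToEquiv A B) (idToEquiv A B q))
      → proj₁ (U A B (idToEquiv A B q)) ≡ w
    centre-unique = proj₂ (U A B (idToEquiv A B q))

≃-from-ua-trans-sym : (U : Univalence ℓ) {A B : Set ℓ} (e f : A ≃ B)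
  → idEquiv A ≡ idToEquiv A A (trans (ua U e) (sym (ua U f))) → e ≡ f
≃-from-ua-trans-sym U {A} {B} e f h = begin
  e                         ≡⟨ sym (idToEquiv-ua U e) ⟩
  idToEquiv A B (ua U e)    ≡⟨ cong (idToEquiv A B) ua-e≡ua-f ⟩
  idToEquiv A B (ua U f)    ≡⟨ idToEquiv-ua U f ⟩
  f                         ∎
  where
  open ≡-Reasoning
  ua-e≡ua-f : ua U e ≡ ua U f
  ua-e≡ua-f = ≡-from-trans-sym (ua U e) (ua U f) (idToEquiv-injective U refl _ h)

module _ (fe : FunExt ℓ) (U : Univalence ℓ) (S : ∈-Structure ℓ) (φ : ∈-Structure.V S → Set ℓ) where
  open ∈-Structure S

  Realiser : V → Set ℓ
  Realiser x = (z : V) → (z ∈ x) ≃ φ z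

  elemEquivThrough : {x y : V} → Realiser x → Realiser y → (z : V) → (z ∈ x) ≃ (z ∈ y)
  elemEquivThrough e f z = idToEquiv _ _ (trans (ua U (e z)) (sym (ua U (f z))))

  realisers-≡ : {x y : V} (p : x ≡ y) (e : Realiser x) (f : Realiser y)
    → idToElemEquiv _∈_ x y p ≡ elemEquivThrough e f → _≡_ {A = Σ V Realiser} (x , e) (y , f)
  realisers-≡ {x} refl e f h =
    cong (x ,_) (fe λ z → ≃-from-ua-trans-sym U (e z) (f z) (cong-app h z))

  realisers-isProp : isProp (Σ V Realiser)
  realisers-isProp (x , e) (y , f) = realisers-≡ (proj₁ path) e f (proj₂ path)
    where
    path : fiber (idToElemEquiv _∈_ x y) (elemEquivThrough e f)
    path = proj₁ (extensional x y (elemEquivThrough e f))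

mainTheorem14 : {ℓ : Level} → FunExt ℓ → Univalence ℓ
    → (S : ∈-Structure ℓ) (φ : ∈-Structure.V S → Set ℓ)
    → isProp (Σ (∈-Structure.V S) λ x → (z : ∈-Structure.V S) → ∈-Structure._∈_ S z x ≃ φ z)
mainTheorem14 = realisers-isProp
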